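{- Let $G$ be a graph with vertex set $V$ and let $U,W\subseteq V$ with $U\cup W=V$. (i) If $U\in\mathcal{R}_0(G)$ and $U\setminus W\in\mathcal{R}_0(G)$, then $I_W(P_U(G))=P_{U\cap W}(\Gamma_{U\setminus W}(G))$. (ii) If $U$ and $W$ are disjoint and $U\in\mathcal{R}_0(G)$, then $I_W(P_U(G))=\Gamma_U(G)$.
   Context: A graph is a finite graph with vertex set $V$, no multiple edges, in which each vertex may or may not carry a loop. Its adjacency matrix $A$ is the symmetric $V\times V$ matrix over $\mathbf{F}_2$ with $A_{vw}=1$ iff $v\ne w$ are adjacent and $A_{vv}=1$ iff $v$ has a loop. $I_X(G)$ is the induced subgraph on $X\subseteq V$. The pivotal poset $\mathcal{R}_0(G)$ is the set of $X\subseteq V$ with $A_{X,X}$ invertible over $\mathbf{F}_2$ (including $\emptyset$). $\oplus$ is symmetric difference; $\mathcal{S}\oplus X=\{Y\oplus X:Y\in\mathcal{S}\}$. For $X\in\mathcal{R}_0(G)$, the pivot $P_X(G)$ is the unique graph on $V$ with pivotal poset $\mathcal{R}_0(G)\oplus X$; its adjacency matrix is $\begin{pmatrix}P^{ -1}&P^{ -1}Q\\ Q^TP^{ -1}&R-Q^TP^{ -1}Q\end{pmatrix}$ where $A=\begin{pmatrix}P&Q\\ Q^T&R\end{pmatrix}$, $P=A_{X,X}$. Graph reduction: for $X\subseteq V$ with this block form, $X$ is reducible if $Q=PM$ for some $M$, and then $\Gamma_X(G)$ is the graph on $V\setminus X$ with adjacency matrix $R-M^TPM$ (independent of $M$; equal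 to $R-Q^TP^{ -1}Q$ if $P$ is invertible). -}

module Defs where

open import Data.Nat using (ℕ)
open import Data.Bool using (Bool; true; false; _∧_; _∨_; not; _xor_)
open import Data.Fin using (Fin; _≟_)
open import Data.List using (foldr; allFin)
open import Data.Product using (Σ; _×_)
open import Relation.Nullary using (does)
open import Relation.Binary.PropositionalEquality using (_≡_)

-- Vertex set V = Fin n.  Matrices over F₂ = Bool (xor = +, ∧ = ·).
Mat : ℕ → Set
Mat n = Fin n → Fin n → Bool

-- A graph (loops allowed, no multiple edges) is a symmetric F₂-matrix.
Symmetric : ∀ {n} → Mat n → Set
Symmetric A = ∀ i j → A i j ≡ A j i

VSet : ℕ → Set
VSet n = Fin n → Bool

_∈_ : ∀ {n} → Fin n → VSet n → Set
i ∈ X = X i ≡ true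

_∉_ : ∀ {n} → Fin n → VSet n → Set
i ∉ X = X i ≡ false

_∩_ : ∀ {n} → VSet n → VSet n → VSet n
(X ∩ Y) i = X i ∧ Y i

_∖_ : ∀ {n} → VSet n → VSet n → VSet n
(X ∖ Y) i = X i ∧ not (Y i)

sumOver : ∀ {n} → VSet n → (Fin n → Bool) → Bool
sumOver {n} X f = foldr (λ k acc → (X k ∧ f k) xor acc) false (allFin n)

δ : ∀ {n} → Fin n → Fin n → Bool
δ i j = does (i ≟ j)

IsInverseOn : ∀ {n} → VSet n → Mat n → Mat n → Set
IsInverseOn X A B =
  (∀ i j → i ∈ X → j ∈ X → sumOver X (λ k → A i k ∧ B k j) ≡ δ i j) ×
  (∀ i j → i ∈ X → j ∈ X → sumOver X (λ k → B i k ∧ A k j) ≡ δ i j)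

InR₀ : ∀ {n} → Mat n → VSet n → Set
InR₀ {n} A X = Σ (Mat n) (IsInverseOn X A)

-- Pivot P_X(G), computed by the block formula from an inverse B of P = A_{X,X}:
--   [ P⁻¹  P⁻¹Q ; QᵀP⁻¹  R - QᵀP⁻¹Q ].
pivot : ∀ {n} → Mat n → VSet n → Mat n → Mat n
pivot A X B i j with X i | X j
... | true  | true  = B i j
... | true  | false = sumOver X (λ k → B i k ∧ A k j)
... | false | true  = sumOver X (λ k → A i k ∧ B k j)
... | false | false = A i j xor sumOver X (λ k → sumOver X (λ l → A i k ∧ B k l ∧ A l j))

-- X reducible via M: Q = P M, i.e. A_{i j} = Σ_{k∈X} A_{i k} M_{k j} for i ∈ X, j ∉ X.
Reducible : ∀ {n} → Mat n → VSet n → Mat n → Set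
Reducible A X M = ∀ i j → i ∈ X → j ∉ X → A i j ≡ sumOver X (λ k → A i k ∧ M k j)

-- Graph reduction Γ_X(G) = R - MᵀPM, a graph on V ∖ X.  Only the entries
-- indexed by (V∖X)×(V∖X) are meaningful; other entries are set to false.
reduce : ∀ {n} → Mat n → VSet n → Mat n → Mat n
reduce A X M i j with X i | X j
... | false | false = A i j xor sumOver X (λ k → sumOver X (λ l → M k i ∧ A k l ∧ M l j))
... | _     | _     = false

-- Equality of graphs on the vertex set W (used for I_W(G) = H with H a graph on W).
EqOn : ∀ {n} → VSet n → Mat n → Mat n → Set
EqOn W A B = ∀ i j → i ∈ W → j ∈ W → A i j ≡ B i j

-- Write U = X ⊔ Y, where X = U ∖ W is the part of the pivot set that is
-- eliminated and Y = U ∩ W the part that survives.  Let B = (A_{U,U})⁻¹ and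
-- let M reduce X, i.e. A_{X,j} = A_{X,X} M_{·,j} for j ∉ X, with reduction
-- Γ = Γ_X(A).  The whole proof rests on one identity: for a column j ∉ X,
-- the column Γ_{Y,j} is the column of A after subtracting A_{·,X} M_{·,j},
-- and that subtraction clears the rows in X.  Hence, for every row vector v,
--     Σ_{k∈Y} v_k Γ_{kj} = Σ_{k∈U} v_k A_{kj} + Σ_{m∈X} (v A)_m M_{mj},
-- and for v a row of B indexed by Y the last term vanishes (BA = 1 on U).
-- Consequently B_{Y,Y} inverts Γ_{Y,Y} (so every inverse C of it equals B
-- there), and each of the four blocks of P_Y(Γ) agrees with the matching
-- block of P_U(A) outside X.  Part (ii) is the case Y = ∅.

module Submission where

open import Defs
open import Data.Nat using (ℕ; zero; suc)
open import Data.Bool using (Bool; true; false; _∧_; _∨_; not; _xor_)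
open import Data.Bool.Properties
  using ( xor-∧-commutativeRing; ∧-commutativeMonoid; ∧-comm; ∧-assoc
        ; ∧-zeroʳ; ∧-identityʳ; ∧-distribˡ-xor; ∧-distribʳ-xor
        ; xor-identityʳ; xor-inverseˡ; xor-same )
open import Data.Fin using (Fin; zero; suc)
open import Data.List using (foldr; tabulate)
open import Data.Product using (Σ; _×_; _,_; proj₁; proj₂)
open import Function using (_∘_; id)
open import Relation.Binary.PropositionalEquality
open import Algebra.Bundles using (CommutativeRing; CommutativeMonoid)
open import Algebra.Properties.Semiring.Sum (CommutativeRing.semiring xor-∧-commutativeRing)
  using (sum; sum-cong-≗; sum-replicate-zero; ∑-distrib-+; ∑-comm; *-distribˡ-sum)
open import Algebra.Properties.CommutativeSemigroup (CommutativeMonoid.commutativeSemigroup ∧-commutativeMonoid)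
  using (x∙yz≈y∙xz; x∙yz≈z∙yx)

open ≡-Reasoning

xor-cancelʳ : ∀ a b s → (a xor s) xor (b xor s) ≡ a xor b
xor-cancelʳ true  true  true  = refl
xor-cancelʳ true  true  false = refl
xor-cancelʳ true  false true  = refl
xor-cancelʳ true  false false = refl
xor-cancelʳ false true  true  = refl
xor-cancelʳ false true  false = refl
xor-cancelʳ false false true  = refl
xor-cancelʳ false false false = refl

δ-sym : ∀ {n} (i j : Fin n) → δ i j ≡ δ j i
δ-sym zero    zero    = refl
δ-sym zero    (suc j) = refl
δ-sym (suc i) zero    = refl
δ-sym (suc i) (suc j) = δ-sym i j

∑-δ : ∀ {n} (i : Fin n) (f : Fin n → Bool) → sum (λ k → δ i k ∧ f k) ≡ f i
∑-δ {suc n} zero f = begin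
  f zero xor sum {n} (λ _ → false) ≡⟨ cong (f zero xor_) (sum-replicate-zero n) ⟩
  f zero xor false                 ≡⟨ xor-identityʳ (f zero) ⟩
  f zero                           ∎
∑-δ (suc i) f = ∑-δ i (f ∘ suc)

module _ {n : ℕ} where

  private
    fold≡∑ : ∀ m (X : VSet n) (f : Fin n → Bool) (g : Fin m → Fin n) →
      foldr (λ k acc → (X k ∧ f k) xor acc) false (tabulate g) ≡ sum (λ k → X (g k) ∧ f (g k))
    fold≡∑ zero    X f g = refl
    fold≡∑ (suc m) X f g = cong ((X (g zero) ∧ f (g zero)) xor_) (fold≡∑ m X f (g ∘ suc))

  sumOver≡∑ : (X : VSet n) (f : Fin n → Bool) → sumOver X f ≡ sum (λ k → X k ∧ f k)
  sumOver≡∑ X f = fold≡∑ n X f id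

  sumOver-cong : (X : VSet n) {f g : Fin n → Bool} →
    (∀ k → k ∈ X → f k ≡ g k) → sumOver X f ≡ sumOver X g
  sumOver-cong X {f} {g} f≡g = begin
    sumOver X f            ≡⟨ sumOver≡∑ X f ⟩
    sum (λ k → X k ∧ f k)  ≡⟨ sum-cong-≗ masked ⟩
    sum (λ k → X k ∧ g k)  ≡⟨ sumOver≡∑ X g ⟨
    sumOver X g            ∎
    where
    masked : ∀ k → X k ∧ f k ≡ X k ∧ g k
    masked k with X k in k∈X
    ... | true  = f≡g k k∈X
    ... | false = refl

  sumOver-xor : (X : VSet n) (f g : Fin n → Bool) →
    sumOver X (λ k → f k xor g k) ≡ sumOver X f xor sumOver X g
  sumOver-xor X f g = begin
    sumOver X (λ k → f k xor g k)                      ≡⟨ sumOver≡∑ X _ ⟩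
    sum (λ k → X k ∧ (f k xor g k))                    ≡⟨ sum-cong-≗ (λ k → ∧-distribˡ-xor (X k) (f k) (g k)) ⟩
    sum (λ k → (X k ∧ f k) xor (X k ∧ g k))            ≡⟨ ∑-distrib-+ (λ k → X k ∧ f k) (λ k → X k ∧ g k) ⟩
    sum (λ k → X k ∧ f k) xor sum (λ k → X k ∧ g k)    ≡⟨ cong₂ _xor_ (sumOver≡∑ X f) (sumOver≡∑ X g) ⟨
    sumOver X f xor sumOver X g                        ∎

  sumOver-∧ˡ : (X : VSet n) (c : Bool) (f : Fin n → Bool) →
    sumOver X (λ k → c ∧ f k) ≡ c ∧ sumOver X f
  sumOver-∧ˡ X c f = begin
    sumOver X (λ k → c ∧ f k)      ≡⟨ sumOver≡∑ X _ ⟩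
    sum (λ k → X k ∧ (c ∧ f k))    ≡⟨ sum-cong-≗ (λ k → x∙yz≈y∙xz (X k) c (f k)) ⟩
    sum (λ k → c ∧ (X k ∧ f k))    ≡⟨ *-distribˡ-sum c (λ k → X k ∧ f k) ⟨
    c ∧ sum (λ k → X k ∧ f k)      ≡⟨ cong (c ∧_) (sumOver≡∑ X f) ⟨
    c ∧ sumOver X f                ∎

  sumOver-∧ʳ : (X : VSet n) (c : Bool) (f : Fin n → Bool) →
    sumOver X (λ k → f k ∧ c) ≡ sumOver X f ∧ c
  sumOver-∧ʳ X c f = begin
    sumOver X (λ k → f k ∧ c)  ≡⟨ sumOver-cong X (λ k _ → ∧-comm (f k) c) ⟩
    sumOver X (λ k → c ∧ f k)  ≡⟨ sumOver-∧ˡ X c f ⟩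
    c ∧ sumOver X f            ≡⟨ ∧-comm c _ ⟩
    sumOver X f ∧ c            ∎

  sumOver-comm : (X Y : VSet n) (f : Fin n → Fin n → Bool) →
    sumOver X (λ k → sumOver Y (λ l → f k l)) ≡ sumOver Y (λ l → sumOver X (λ k → f k l))
  sumOver-comm X Y f = begin
    sumOver X (λ k → sumOver Y (f k))                ≡⟨ sumOver-cong X (λ k _ → sumOver≡∑ Y (f k)) ⟩
    sumOver X (λ k → sum (λ l → Y l ∧ f k l))         ≡⟨ sumOver≡∑ X _ ⟩
    sum (λ k → X k ∧ sum (λ l → Y l ∧ f k l))         ≡⟨ sum-cong-≗ (λ k → *-distribˡ-sum (X k) (λ l → Y l ∧ f k l)) ⟩
    sum (λ k → sum (λ l → X k ∧ (Y l ∧ f k l)))       ≡⟨ ∑-comm (λ k l → X k ∧ (Y l ∧ f k l)) ⟩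
    sum (λ l → sum (λ k → X k ∧ (Y l ∧ f k l)))       ≡⟨ sum-cong-≗ (λ l → sum-cong-≗ (λ k → x∙yz≈y∙xz (X k) (Y l) (f k l))) ⟩
    sum (λ l → sum (λ k → Y l ∧ (X k ∧ f k l)))       ≡⟨ sum-cong-≗ (λ l → *-distribˡ-sum (Y l) (λ k → X k ∧ f k l)) ⟨
    sum (λ l → Y l ∧ sum (λ k → X k ∧ f k l))         ≡⟨ sumOver≡∑ Y _ ⟨
    sumOver Y (λ l → sum (λ k → X k ∧ f k l))         ≡⟨ sumOver-cong Y (λ l _ → sumOver≡∑ X (λ k → f k l)) ⟨
    sumOver Y (λ l → sumOver X (λ k → f k l))         ∎

  sumOver-assoc : (X Y : VSet n) (a : Fin n → Bool) (b : Fin n → Fin n → Bool) (c : Fin n → Bool) →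
    sumOver X (λ k → a k ∧ sumOver Y (λ l → b k l ∧ c l)) ≡
    sumOver Y (λ l → sumOver X (λ k → a k ∧ b k l) ∧ c l)
  sumOver-assoc X Y a b c = begin
    sumOver X (λ k → a k ∧ sumOver Y (λ l → b k l ∧ c l))    ≡⟨ sumOver-cong X (λ k _ → sumOver-∧ˡ Y (a k) _) ⟨
    sumOver X (λ k → sumOver Y (λ l → a k ∧ (b k l ∧ c l)))  ≡⟨ sumOver-comm X Y _ ⟩
    sumOver Y (λ l → sumOver X (λ k → a k ∧ (b k l ∧ c l)))  ≡⟨ sumOver-cong Y (λ l _ → sumOver-cong X (λ k _ → ∧-assoc (a k) (b k l) (c l))) ⟨
    sumOver Y (λ l → sumOver X (λ k → (a k ∧ b k l) ∧ c l))  ≡⟨ sumOver-cong Y (λ l _ → sumOver-∧ʳ X (c l) _) ⟩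
    sumOver Y (λ l → sumOver X (λ k → a k ∧ b k l) ∧ c l)    ∎

  sumOver-δ : (X : VSet n) (i : Fin n) (f : Fin n → Bool) → sumOver X (λ k → δ i k ∧ f k) ≡ X i ∧ f i
  sumOver-δ X i f = begin
    sumOver X (λ k → δ i k ∧ f k)     ≡⟨ sumOver≡∑ X _ ⟩
    sum (λ k → X k ∧ (δ i k ∧ f k))   ≡⟨ sum-cong-≗ (λ k → x∙yz≈y∙xz (X k) (δ i k) (f k)) ⟩
    sum (λ k → δ i k ∧ (X k ∧ f k))   ≡⟨ ∑-δ i (λ k → X k ∧ f k) ⟩
    X i ∧ f i                         ∎

  sumOver-⊔ : (U X Y : VSet n) → (∀ k → U k ≡ X k xor Y k) → (f : Fin n → Bool) →
    sumOver U f ≡ sumOver X f xor sumOver Y f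
  sumOver-⊔ U X Y U≡X⊔Y f = begin
    sumOver U f                                       ≡⟨ sumOver≡∑ U f ⟩
    sum (λ k → U k ∧ f k)                             ≡⟨ sum-cong-≗ (λ k → trans (cong (_∧ f k) (U≡X⊔Y k)) (∧-distribʳ-xor (f k) (X k) (Y k))) ⟩
    sum (λ k → (X k ∧ f k) xor (Y k ∧ f k))           ≡⟨ ∑-distrib-+ (λ k → X k ∧ f k) (λ k → Y k ∧ f k) ⟩
    sum (λ k → X k ∧ f k) xor sum (λ k → Y k ∧ f k)   ≡⟨ cong₂ _xor_ (sumOver≡∑ X f) (sumOver≡∑ Y f) ⟨
    sumOver X f xor sumOver Y f                       ∎

  sumOver-∅ : (f : Fin n → Bool) → sumOver (λ _ → false) f ≡ false
  sumOver-∅ f = trans (sumOver≡∑ (λ _ → false) f) (sum-replicate-zero n)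

module _ {n : ℕ} where

  inverse-unique : (X : VSet n) (A C D : Mat n) →
    (∀ i j → i ∈ X → j ∈ X → sumOver X (λ k → C i k ∧ A k j) ≡ δ i j) →
    (∀ i j → i ∈ X → j ∈ X → sumOver X (λ k → A i k ∧ D k j) ≡ δ i j) →
    ∀ i j → i ∈ X → j ∈ X → C i j ≡ D i j
  inverse-unique X A C D CA≡1 AD≡1 i j i∈X j∈X = begin
    C i j                                                    ≡⟨ cong (_∧ C i j) j∈X ⟨
    X j ∧ C i j                                              ≡⟨ sumOver-δ X j (C i) ⟨
    sumOver X (λ l → δ j l ∧ C i l)                          ≡⟨ sumOver-cong X (λ l _ → trans (cong (_∧ C i l) (δ-sym j l)) (∧-comm (δ l j) (C i l))) ⟩
    sumOver X (λ l → C i l ∧ δ l j)                          ≡⟨ sumOver-cong X (λ l l∈X → cong (C i l ∧_) (AD≡1 l j l∈X j∈X)) ⟨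
    sumOver X (λ l → C i l ∧ sumOver X (λ k → A l k ∧ D k j)) ≡⟨ sumOver-assoc X X (C i) A (λ k → D k j) ⟩
    sumOver X (λ k → sumOver X (λ l → C i l ∧ A l k) ∧ D k j) ≡⟨ sumOver-cong X (λ k k∈X → cong (_∧ D k j) (CA≡1 i k i∈X k∈X)) ⟩
    sumOver X (λ k → δ i k ∧ D k j)                          ≡⟨ sumOver-δ X i (λ k → D k j) ⟩
    X i ∧ D i j                                              ≡⟨ cong (_∧ D i j) i∈X ⟩
    D i j                                                    ∎

  -- The inverse of a symmetric matrix is symmetric: its transpose is a left inverse.
  inverse-symmetric : (X : VSet n) (A B : Mat n) → Symmetric A → IsInverseOn X A B →
    ∀ i j → i ∈ X → j ∈ X → B j i ≡ B i j
  inverse-symmetric X A B A-sym (AB≡1 , _) = inverse-unique X A (λ i j → B j i) B Bᵀ-left AB≡1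
    where
    Bᵀ-left : ∀ i j → i ∈ X → j ∈ X → sumOver X (λ k → B k i ∧ A k j) ≡ δ i j
    Bᵀ-left i j i∈X j∈X = begin
      sumOver X (λ k → B k i ∧ A k j)  ≡⟨ sumOver-cong X (λ k _ → trans (∧-comm (B k i) (A k j)) (cong (_∧ B k i) (A-sym k j))) ⟩
      sumOver X (λ k → A j k ∧ B k i)  ≡⟨ AB≡1 j i j∈X i∈X ⟩
      δ j i                            ≡⟨ δ-sym j i ⟩
      δ i j                            ∎

  -- An invertible block is reducible, with M = P⁻¹ Q.
  reducible-of-invertible : (A : Mat n) (X : VSet n) → InR₀ A X → Σ (Mat n) (Reducible A X)
  reducible-of-invertible A X (D , AD≡1 , _) = (λ k j → sumOver X (λ l → D k l ∧ A l j)) , P·P⁻¹Q≡Q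
    where
    P·P⁻¹Q≡Q : Reducible A X (λ k j → sumOver X (λ l → D k l ∧ A l j))
    P·P⁻¹Q≡Q i j i∈X _ = sym (begin
      sumOver X (λ k → A i k ∧ sumOver X (λ l → D k l ∧ A l j))  ≡⟨ sumOver-assoc X X (A i) D (λ l → A l j) ⟩
      sumOver X (λ l → sumOver X (λ k → A i k ∧ D k l) ∧ A l j)  ≡⟨ sumOver-cong X (λ l l∈X → cong (_∧ A l j) (AD≡1 i l i∈X l∈X)) ⟩
      sumOver X (λ l → δ i l ∧ A l j)                            ≡⟨ sumOver-δ X i (λ l → A l j) ⟩
      X i ∧ A i j                                                ≡⟨ cong (_∧ A i j) i∈X ⟩
      A i j                                                      ∎)

module _ {n : ℕ} (A : Mat n) (X : VSet n) where

  pivot-in-in : (B : Mat n) → ∀ i j → i ∈ X → j ∈ X → pivot A X B i j ≡ B i j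
  pivot-in-in B i j i∈X j∈X rewrite i∈X | j∈X = refl

  pivot-in-out : (B : Mat n) → ∀ i j → i ∈ X → j ∉ X →
    pivot A X B i j ≡ sumOver X (λ k → B i k ∧ A k j)
  pivot-in-out B i j i∈X j∉X rewrite i∈X | j∉X = refl

  pivot-out-in : (B : Mat n) → ∀ i j → i ∉ X → j ∈ X →
    pivot A X B i j ≡ sumOver X (λ k → A i k ∧ B k j)
  pivot-out-in B i j i∉X j∈X rewrite i∉X | j∈X = refl

  pivot-out-out : (B : Mat n) → ∀ i j → i ∉ X → j ∉ X →
    pivot A X B i j ≡ A i j xor sumOver X (λ k → sumOver X (λ l → A i k ∧ B k l ∧ A l j))
  pivot-out-out B i j i∉X j∉X rewrite i∉X | j∉X = refl

  reduce-out-out : (M : Mat n) → ∀ i j → i ∉ X → j ∉ X →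
    reduce A X M i j ≡ A i j xor sumOver X (λ k → sumOver X (λ l → M k i ∧ A k l ∧ M l j))
  reduce-out-out M i j i∉X j∉X rewrite i∉X | j∉X = refl

  reduce-symmetric : Symmetric A → (M : Mat n) → Symmetric (reduce A X M)
  reduce-symmetric A-sym M i j with X i | X j
  ... | true  | true  = refl
  ... | true  | false = refl
  ... | false | true  = refl
  ... | false | false = begin
    A i j xor sumOver X (λ k → sumOver X (λ l → M k i ∧ A k l ∧ M l j))  ≡⟨ cong₂ _xor_ (A-sym i j) (sumOver-comm X X _) ⟩
    A j i xor sumOver X (λ l → sumOver X (λ k → M k i ∧ A k l ∧ M l j))  ≡⟨ cong (A j i xor_) (sumOver-cong X (λ l _ → sumOver-cong X (λ k _ → MᵀAM-transpose k l))) ⟩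
    A j i xor sumOver X (λ l → sumOver X (λ k → M l j ∧ A l k ∧ M k i))  ∎
    where
    MᵀAM-transpose : ∀ k l → M k i ∧ A k l ∧ M l j ≡ M l j ∧ A l k ∧ M k i
    MᵀAM-transpose k l = trans (x∙yz≈z∙yx (M k i) (A k l) (M l j)) (cong (λ a → M l j ∧ a ∧ M k i) (A-sym k l))

module PivotOfReduction {n : ℕ} (A : Mat n) (A-sym : Symmetric A) (U X Y : VSet n)
  (U≡X⊔Y : ∀ k → U k ≡ X k xor Y k) (X∩Y≡∅ : ∀ k → X k ∧ Y k ≡ false)
  (B : Mat n) (B-inv : IsInverseOn U A B) (M : Mat n) (M-red : Reducible A X M) where

  Γ : Mat n
  Γ = reduce A X M

  Γ-sym : Symmetric Γ
  Γ-sym = reduce-symmetric A X A-sym M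

  AB≡1 : ∀ i j → i ∈ U → j ∈ U → sumOver U (λ k → A i k ∧ B k j) ≡ δ i j
  AB≡1 = proj₁ B-inv

  BA≡1 : ∀ i j → i ∈ U → j ∈ U → sumOver U (λ k → B i k ∧ A k j) ≡ δ i j
  BA≡1 = proj₂ B-inv

  B-sym : ∀ i j → i ∈ U → j ∈ U → B j i ≡ B i j
  B-sym = inverse-symmetric U A B A-sym B-inv

  U≡Y-off-X : ∀ k → k ∉ X → U k ≡ Y k
  U≡Y-off-X k k∉X = trans (U≡X⊔Y k) (cong (_xor Y k) k∉X)

  Y⊆∁X : ∀ k → k ∈ Y → k ∉ X
  Y⊆∁X k k∈Y = trans (sym (∧-identityʳ (X k))) (subst (λ y → X k ∧ y ≡ false) k∈Y (X∩Y≡∅ k))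

  Y⊆U : ∀ k → k ∈ Y → k ∈ U
  Y⊆U k k∈Y = trans (U≡Y-off-X k (Y⊆∁X k k∈Y)) k∈Y

  X⊆U : ∀ k → k ∈ X → k ∈ U
  X⊆U k k∈X = begin
    U k          ≡⟨ U≡X⊔Y k ⟩
    X k xor Y k  ≡⟨ cong₂ _xor_ k∈X (subst (λ x → x ∧ Y k ≡ false) k∈X (X∩Y≡∅ k)) ⟩
    true         ∎

  E : Mat n
  E k j = A k j xor sumOver X (λ m → A k m ∧ M m j)

  E-vanishes-on-X : ∀ k j → k ∈ X → j ∉ X → E k j ≡ false
  E-vanishes-on-X k j k∈X j∉X = trans (cong (_xor sumOver X (λ m → A k m ∧ M m j)) (M-red k j k∈X j∉X)) (xor-same (sumOver X (λ m → A k m ∧ M m j)))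

  -- Outside X the reduction R - MᵀPM is E, since MᵀP = Mᵀ Pᵀ = Qᵀ.
  Γ≡E : ∀ i j → i ∉ X → j ∉ X → Γ i j ≡ E i j
  Γ≡E i j i∉X j∉X = begin
    Γ i j                                                                 ≡⟨ reduce-out-out A X M i j i∉X j∉X ⟩
    A i j xor sumOver X (λ k → sumOver X (λ l → M k i ∧ A k l ∧ M l j))   ≡⟨ cong (A i j xor_) MᵀPM≡QᵀM ⟩
    E i j                                                                 ∎
    where
    MᵀP≡Qᵀ : ∀ l → l ∈ X → sumOver X (λ k → M k i ∧ A k l) ≡ A i l
    MᵀP≡Qᵀ l l∈X = begin
      sumOver X (λ k → M k i ∧ A k l)  ≡⟨ sumOver-cong X (λ k _ → trans (∧-comm (M k i) (A k l)) (cong (_∧ M k i) (A-sym k l))) ⟩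
      sumOver X (λ k → A l k ∧ M k i)  ≡⟨ M-red l i l∈X i∉X ⟨
      A l i                            ≡⟨ A-sym l i ⟩
      A i l                            ∎
    MᵀPM≡QᵀM : sumOver X (λ k → sumOver X (λ l → M k i ∧ A k l ∧ M l j)) ≡ sumOver X (λ l → A i l ∧ M l j)
    MᵀPM≡QᵀM = begin
      sumOver X (λ k → sumOver X (λ l → M k i ∧ A k l ∧ M l j))  ≡⟨ sumOver-cong X (λ k _ → sumOver-∧ˡ X (M k i) _) ⟩
      sumOver X (λ k → M k i ∧ sumOver X (λ l → A k l ∧ M l j))  ≡⟨ sumOver-assoc X X (λ k → M k i) A (λ l → M l j) ⟩
      sumOver X (λ l → sumOver X (λ k → M k i ∧ A k l) ∧ M l j)  ≡⟨ sumOver-cong X (λ l l∈X → cong (_∧ M l j) (MᵀP≡Qᵀ l l∈X)) ⟩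
      sumOver X (λ l → A i l ∧ M l j)                            ∎

  vΓ≡vA+vAM : ∀ (v : Fin n → Bool) j → j ∉ X →
    sumOver Y (λ k → v k ∧ Γ k j) ≡
    sumOver U (λ k → v k ∧ A k j) xor sumOver X (λ m → sumOver U (λ k → v k ∧ A k m) ∧ M m j)
  vΓ≡vA+vAM v j j∉X = begin
    sumOver Y (λ k → v k ∧ Γ k j)                                    ≡⟨ sumOver-cong Y (λ k k∈Y → cong (v k ∧_) (Γ≡E k j (Y⊆∁X k k∈Y) j∉X)) ⟩
    sumOver Y (λ k → v k ∧ E k j)                                    ≡⟨ cong (_xor sumOver Y (λ k → v k ∧ E k j)) vE-vanishes-on-X ⟨
    sumOver X (λ k → v k ∧ E k j) xor sumOver Y (λ k → v k ∧ E k j)  ≡⟨ sumOver-⊔ U X Y U≡X⊔Y _ ⟨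
    sumOver U (λ k → v k ∧ E k j)                                    ≡⟨ sumOver-cong U (λ k _ → ∧-distribˡ-xor (v k) _ _) ⟩
    sumOver U (λ k → (v k ∧ A k j) xor (v k ∧ sumOver X (λ m → A k m ∧ M m j)))  ≡⟨ sumOver-xor U _ _ ⟩
    sumOver U (λ k → v k ∧ A k j) xor sumOver U (λ k → v k ∧ sumOver X (λ m → A k m ∧ M m j))
      ≡⟨ cong (sumOver U (λ k → v k ∧ A k j) xor_) (sumOver-assoc U X v A (λ m → M m j)) ⟩
    sumOver U (λ k → v k ∧ A k j) xor sumOver X (λ m → sumOver U (λ k → v k ∧ A k m) ∧ M m j)  ∎
    where
    vE-vanishes-on-X : sumOver X (λ k → v k ∧ E k j) ≡ false
    vE-vanishes-on-X = begin
      sumOver X (λ k → v k ∧ E k j)  ≡⟨ sumOver-cong X (λ k k∈X → trans (cong (v k ∧_) (E-vanishes-on-X k j k∈X j∉X)) (∧-zeroʳ (v k))) ⟩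
      sumOver X (λ _ → false)        ≡⟨ sumOver-∧ˡ X false (λ _ → false) ⟩
      false                          ∎

  -- For a row i ∈ Y of B the correction term vanishes, because (BA)_{im} = δ_{im} ≠ 1 for m ∈ X.
  BΓ≡BA : ∀ i j → i ∈ Y → j ∉ X → sumOver Y (λ k → B i k ∧ Γ k j) ≡ sumOver U (λ k → B i k ∧ A k j)
  BΓ≡BA i j i∈Y j∉X = begin
    sumOver Y (λ k → B i k ∧ Γ k j)                                  ≡⟨ vΓ≡vA+vAM (B i) j j∉X ⟩
    sumOver U (λ k → B i k ∧ A k j) xor sumOver X (λ m → sumOver U (λ k → B i k ∧ A k m) ∧ M m j)
      ≡⟨ cong (sumOver U (λ k → B i k ∧ A k j) xor_) correction-vanishes ⟩
    sumOver U (λ k → B i k ∧ A k j) xor false                        ≡⟨ xor-identityʳ _ ⟩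
    sumOver U (λ k → B i k ∧ A k j)                                  ∎
    where
    correction-vanishes : sumOver X (λ m → sumOver U (λ k → B i k ∧ A k m) ∧ M m j) ≡ false
    correction-vanishes = begin
      sumOver X (λ m → sumOver U (λ k → B i k ∧ A k m) ∧ M m j)
        ≡⟨ sumOver-cong X (λ m m∈X → cong (_∧ M m j) (BA≡1 i m (Y⊆U i i∈Y) (X⊆U m m∈X))) ⟩
      sumOver X (λ m → δ i m ∧ M m j)  ≡⟨ sumOver-δ X i (λ m → M m j) ⟩
      X i ∧ M i j                      ≡⟨ cong (_∧ M i j) (Y⊆∁X i i∈Y) ⟩
      false                            ∎

  ΓB-transpose : ∀ i k j → k ∈ U → j ∈ U → Γ i k ∧ B k j ≡ B j k ∧ Γ k i
  ΓB-transpose i k j k∈U j∈U = trans (∧-comm (Γ i k) (B k j)) (cong₂ _∧_ (B-sym j k j∈U k∈U) (Γ-sym i k))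

  B-inverts-Γ : IsInverseOn Y Γ B
  B-inverts-Γ = ΓB≡1 , BΓ≡1
    where
    BΓ≡1 : ∀ i j → i ∈ Y → j ∈ Y → sumOver Y (λ k → B i k ∧ Γ k j) ≡ δ i j
    BΓ≡1 i j i∈Y j∈Y = trans (BΓ≡BA i j i∈Y (Y⊆∁X j j∈Y)) (BA≡1 i j (Y⊆U i i∈Y) (Y⊆U j j∈Y))
    ΓB≡1 : ∀ i j → i ∈ Y → j ∈ Y → sumOver Y (λ k → Γ i k ∧ B k j) ≡ δ i j
    ΓB≡1 i j i∈Y j∈Y = begin
      sumOver Y (λ k → Γ i k ∧ B k j)  ≡⟨ sumOver-cong Y (λ k k∈Y → ΓB-transpose i k j (Y⊆U k k∈Y) (Y⊆U j j∈Y)) ⟩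
      sumOver Y (λ k → B j k ∧ Γ k i)  ≡⟨ BΓ≡1 j i j∈Y i∈Y ⟩
      δ j i                            ≡⟨ δ-sym j i ⟩
      δ i j                            ∎

  BA : Mat n
  BA k j = sumOver U (λ l → B k l ∧ A l j)

  A-BA≡A : ∀ m j → m ∈ U → sumOver U (λ k → A m k ∧ BA k j) ≡ A m j
  A-BA≡A m j m∈U = begin
    sumOver U (λ k → A m k ∧ BA k j)                           ≡⟨ sumOver-assoc U U (A m) B (λ l → A l j) ⟩
    sumOver U (λ l → sumOver U (λ k → A m k ∧ B k l) ∧ A l j)  ≡⟨ sumOver-cong U (λ l l∈U → cong (_∧ A l j) (AB≡1 m l m∈U l∈U)) ⟩
    sumOver U (λ l → δ m l ∧ A l j)                            ≡⟨ sumOver-δ U m (λ l → A l j) ⟩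
    U m ∧ A m j                                                ≡⟨ cong (_∧ A m j) m∈U ⟩
    A m j                                                      ∎

  module _ (C : Mat n) (C-inv : IsInverseOn Y Γ C) where

    C≡B : ∀ k l → k ∈ Y → l ∈ Y → C k l ≡ B k l
    C≡B = inverse-unique Y Γ C B (proj₂ C-inv) (proj₁ B-inverts-Γ)

    agree-in-in : ∀ i j → i ∈ Y → j ∈ Y → pivot A U B i j ≡ pivot Γ Y C i j
    agree-in-in i j i∈Y j∈Y = begin
      pivot A U B i j  ≡⟨ pivot-in-in A U B i j (Y⊆U i i∈Y) (Y⊆U j j∈Y) ⟩
      B i j            ≡⟨ C≡B i j i∈Y j∈Y ⟨
      C i j            ≡⟨ pivot-in-in Γ Y C i j i∈Y j∈Y ⟨
      pivot Γ Y C i j  ∎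

    agree-in-out : ∀ i j → i ∈ Y → j ∉ X → j ∉ Y → pivot A U B i j ≡ pivot Γ Y C i j
    agree-in-out i j i∈Y j∉X j∉Y = begin
      pivot A U B i j                  ≡⟨ pivot-in-out A U B i j (Y⊆U i i∈Y) (trans (U≡Y-off-X j j∉X) j∉Y) ⟩
      BA i j                           ≡⟨ BΓ≡BA i j i∈Y j∉X ⟨
      sumOver Y (λ k → B i k ∧ Γ k j)  ≡⟨ sumOver-cong Y (λ k k∈Y → cong (_∧ Γ k j) (C≡B i k i∈Y k∈Y)) ⟨
      sumOver Y (λ k → C i k ∧ Γ k j)  ≡⟨ pivot-in-out Γ Y C i j i∈Y j∉Y ⟨
      pivot Γ Y C i j                  ∎

    agree-out-in : ∀ i j → i ∉ X → i ∉ Y → j ∈ Y → pivot A U B i j ≡ pivot Γ Y C i j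
    agree-out-in i j i∉X i∉Y j∈Y = begin
      pivot A U B i j                  ≡⟨ pivot-out-in A U B i j (trans (U≡Y-off-X i i∉X) i∉Y) (Y⊆U j j∈Y) ⟩
      sumOver U (λ k → A i k ∧ B k j)  ≡⟨ sumOver-cong U (λ k k∈U → AB-transpose k k∈U) ⟩
      BA j i                           ≡⟨ BΓ≡BA j i j∈Y i∉X ⟨
      sumOver Y (λ k → B j k ∧ Γ k i)  ≡⟨ sumOver-cong Y ΓC-transpose ⟨
      sumOver Y (λ k → Γ i k ∧ C k j)  ≡⟨ pivot-out-in Γ Y C i j i∉Y j∈Y ⟨
      pivot Γ Y C i j                  ∎
      where
      AB-transpose : ∀ k → k ∈ U → A i k ∧ B k j ≡ B j k ∧ A k i
      AB-transpose k k∈U = trans (∧-comm (A i k) (B k j)) (cong₂ _∧_ (B-sym j k (Y⊆U j j∈Y) k∈U) (A-sym i k))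
      ΓC-transpose : ∀ k → k ∈ Y → Γ i k ∧ C k j ≡ B j k ∧ Γ k i
      ΓC-transpose k k∈Y = trans (cong (Γ i k ∧_) (C≡B k j k∈Y j∈Y)) (ΓB-transpose i k j (Y⊆U k k∈Y) (Y⊆U j j∈Y))

    Γ-correction : ∀ i j → i ∉ X → j ∉ X →
      sumOver Y (λ k → sumOver Y (λ l → Γ i k ∧ C k l ∧ Γ l j)) ≡
      sumOver U (λ k → A i k ∧ BA k j) xor sumOver X (λ m → A j m ∧ M m i)
    Γ-correction i j i∉X j∉X = begin
      sumOver Y (λ k → sumOver Y (λ l → Γ i k ∧ C k l ∧ Γ l j))
        ≡⟨ sumOver-cong Y (λ k k∈Y → trans (sumOver-∧ˡ Y (Γ i k) _) (cong (Γ i k ∧_) (CΓ≡BA k k∈Y))) ⟩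
      sumOver Y (λ k → Γ i k ∧ BA k j)
        ≡⟨ sumOver-cong Y (λ k _ → trans (∧-comm (Γ i k) (BA k j)) (cong (BA k j ∧_) (Γ-sym i k))) ⟩
      sumOver Y (λ k → BA k j ∧ Γ k i)
        ≡⟨ vΓ≡vA+vAM (λ k → BA k j) i i∉X ⟩
      sumOver U (λ k → BA k j ∧ A k i) xor sumOver X (λ m → sumOver U (λ k → BA k j ∧ A k m) ∧ M m i)
        ≡⟨ cong₂ _xor_ (sumOver-cong U (λ k _ → BA-A-transpose k i))
                       (sumOver-cong X (λ m m∈X → cong (_∧ M m i) (BA-A≡A m m∈X))) ⟩
      sumOver U (λ k → A i k ∧ BA k j) xor sumOver X (λ m → A j m ∧ M m i)  ∎
      where
      CΓ≡BA : ∀ k → k ∈ Y → sumOver Y (λ l → C k l ∧ Γ l j) ≡ BA k j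
      CΓ≡BA k k∈Y = trans (sumOver-cong Y (λ l l∈Y → cong (_∧ Γ l j) (C≡B k l k∈Y l∈Y))) (BΓ≡BA k j k∈Y j∉X)
      BA-A-transpose : ∀ k m → BA k j ∧ A k m ≡ A m k ∧ BA k j
      BA-A-transpose k m = trans (∧-comm (BA k j) (A k m)) (cong (_∧ BA k j) (A-sym k m))
      BA-A≡A : ∀ m → m ∈ X → sumOver U (λ k → BA k j ∧ A k m) ≡ A j m
      BA-A≡A m m∈X = trans (sumOver-cong U (λ k _ → BA-A-transpose k m)) (trans (A-BA≡A m j (X⊆U m m∈X)) (A-sym m j))

    agree-out-out : ∀ i j → i ∉ X → j ∉ X → i ∉ Y → j ∉ Y → pivot A U B i j ≡ pivot Γ Y C i j
    agree-out-out i j i∉X j∉X i∉Y j∉Y = begin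
      pivot A U B i j
        ≡⟨ pivot-out-out A U B i j (trans (U≡Y-off-X i i∉X) i∉Y) (trans (U≡Y-off-X j j∉X) j∉Y) ⟩
      A i j xor sumOver U (λ k → sumOver U (λ l → A i k ∧ B k l ∧ A l j))
        ≡⟨ cong (A i j xor_) (sumOver-cong U (λ k _ → sumOver-∧ˡ U (A i k) _)) ⟩
      A i j xor S                ≡⟨ xor-cancelʳ (A i j) S T ⟨
      (A i j xor T) xor (S xor T) ≡⟨ cong₂ _xor_ Γij≡Aij+T (Γ-correction i j i∉X j∉X) ⟨
      Γ i j xor sumOver Y (λ k → sumOver Y (λ l → Γ i k ∧ C k l ∧ Γ l j))
        ≡⟨ pivot-out-out Γ Y C i j i∉Y j∉Y ⟨
      pivot Γ Y C i j            ∎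
      where
      S T : Bool
      S = sumOver U (λ k → A i k ∧ BA k j)
      T = sumOver X (λ m → A j m ∧ M m i)
      Γij≡Aij+T : Γ i j ≡ A i j xor T
      Γij≡Aij+T = trans (Γ-sym i j) (trans (Γ≡E j i j∉X i∉X) (cong (_xor T) (A-sym j i)))

    -- Outside X, U and Y have the same members, so one of the four blocks applies.
    pivots-agree : ∀ i j → i ∉ X → j ∉ X → pivot A U B i j ≡ pivot Γ Y C i j
    pivots-agree i j i∉X j∉X = by-membership (Y i) refl (Y j) refl
      where
      by-membership : ∀ a → Y i ≡ a → ∀ b → Y j ≡ b → pivot A U B i j ≡ pivot Γ Y C i j
      by-membership true  i∈Y true  j∈Y = agree-in-in i j i∈Y j∈Y
      by-membership true  i∈Y false j∉Y = agree-in-out i j i∈Y j∉X j∉Y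
      by-membership false i∉Y true  j∈Y = agree-out-in i j i∉X i∉Y j∈Y
      by-membership false i∉Y false j∉Y = agree-out-out i j i∉X j∉X i∉Y j∉Y

module _ {n : ℕ} (U W : VSet n) where

  ∖-∩-partition : ∀ k → U k ≡ (U ∖ W) k xor (U ∩ W) k
  ∖-∩-partition k = begin
    U k                        ≡⟨ ∧-identityʳ (U k) ⟨
    U k ∧ true                 ≡⟨ cong (U k ∧_) (xor-inverseˡ (W k)) ⟨
    U k ∧ (not (W k) xor W k)  ≡⟨ ∧-distribˡ-xor (U k) (not (W k)) (W k) ⟩
    (U ∖ W) k xor (U ∩ W) k    ∎

  ∖-∩-disjoint : ∀ k → (U ∖ W) k ∧ (U ∩ W) k ≡ false
  ∖-∩-disjoint k with U k | W k
  ... | false | _     = refl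
  ... | true  | true  = refl
  ... | true  | false = refl

  ∈-∉-∖ : ∀ i → i ∈ W → i ∉ (U ∖ W)
  ∈-∉-∖ i i∈W = trans (cong (λ w → U i ∧ not w) i∈W) (∧-zeroʳ (U i))

  ∈-∉-disjoint : (∀ k → U k ∧ W k ≡ false) → ∀ i → i ∈ W → i ∉ U
  ∈-∉-disjoint U∩W≡∅ i i∈W = trans (sym (∧-identityʳ (U i))) (subst (λ w → U i ∧ w ≡ false) i∈W (U∩W≡∅ i))

pivot-∅ : ∀ {n} (A B : Mat n) i j → pivot A (λ _ → false) B i j ≡ A i j
pivot-∅ A B i j = trans (cong (A i j xor_) (sumOver-∅ (λ k → sumOver (λ _ → false) (λ l → A i k ∧ B k l ∧ A l j)))) (xor-identityʳ (A i j))

-- Theorem 16.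

mainTheorem16 : ∀ {n : ℕ} (A : Mat n) → Symmetric A → (U W : VSet n) → (∀ i → U i ∨ W i ≡ true) →
    ((B : Mat n) → IsInverseOn U A B → InR₀ A (U ∖ W) →
    Σ (Mat n) (Reducible A (U ∖ W)) ×
    ((M : Mat n) → Reducible A (U ∖ W) M →
    InR₀ (reduce A (U ∖ W) M) (U ∩ W) ×
    ((C : Mat n) → IsInverseOn (U ∩ W) (reduce A (U ∖ W) M) C →
    EqOn W (pivot A U B) (pivot (reduce A (U ∖ W) M) (U ∩ W) C))))
    ×
    ((∀ i → U i ∧ W i ≡ false) → (B : Mat n) → IsInverseOn U A B →
    Σ (Mat n) (Reducible A U) ×
    ((M : Mat n) → Reducible A U M → EqOn W (pivot A U B) (reduce A U M)))
mainTheorem16 {n} A A-sym U W _ = part-i , part-ii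
  where
  -- (i): compare along the partition U = (U ∖ W) ⊔ (U ∩ W); W avoids U ∖ W.
  part-i : (B : Mat n) → IsInverseOn U A B → InR₀ A (U ∖ W) →
    Σ (Mat n) (Reducible A (U ∖ W)) ×
    ((M : Mat n) → Reducible A (U ∖ W) M →
    InR₀ (reduce A (U ∖ W) M) (U ∩ W) ×
    ((C : Mat n) → IsInverseOn (U ∩ W) (reduce A (U ∖ W) M) C →
    EqOn W (pivot A U B) (pivot (reduce A (U ∖ W) M) (U ∩ W) C)))
  part-i B B-inv U∖W∈R₀ = reducible-of-invertible A (U ∖ W) U∖W∈R₀ , λ M M-red →
    let open PivotOfReduction A A-sym U (U ∖ W) (U ∩ W) (∖-∩-partition U W) (∖-∩-disjoint U W) B B-inv M M-red
    in (B , B-inverts-Γ) , λ C C-inv i j i∈W j∈W →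
         pivots-agree C C-inv i j (∈-∉-∖ U W i i∈W) (∈-∉-∖ U W j j∈W)

  -- (ii): compare along the partition U = U ⊔ ∅; pivoting on ∅ is the identity.
  part-ii : (∀ i → U i ∧ W i ≡ false) → (B : Mat n) → IsInverseOn U A B →
    Σ (Mat n) (Reducible A U) ×
    ((M : Mat n) → Reducible A U M → EqOn W (pivot A U B) (reduce A U M))
  part-ii U∩W≡∅ B B-inv = reducible-of-invertible A U (B , B-inv) , λ M M-red →
    let open PivotOfReduction A A-sym U U (λ _ → false) (λ k → sym (xor-identityʳ (U k))) (λ k → ∧-zeroʳ (U k)) B B-inv M M-red
    in λ i j i∈W j∈W →
         trans (pivots-agree B B-inverts-Γ i j (∈-∉-disjoint U W U∩W≡∅ i i∈W) (∈-∉-disjoint U W U∩W≡∅ j j∈W))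
               (pivot-∅ Γ B i j)
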